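{- Fix an extended type $\tau=(\tau_1,\tau_2)$. Let $\mathbf{Lat}^*$ be the category of complete lattices with morphisms the maps preserving $0,1$, arbitrary joins and arbitrary meets; let $\mathbf{Rel}^{\uparrow}_\tau$ be the category of ordered extended relational structures of type $\tau$ with order $p$-morphisms; and let $\mathbf{Alg}_\tau$ be the category of bounded lattices with additional operations of types $\tau_1$ and $\tau_2$ and their homomorphisms. Then there is a bifunctor $\mathbf{Lat}^*\times\mathbf{Rel}^{\uparrow}_\tau\to\mathbf{Alg}_\tau$, covariant in the first argument and contravariant in the second, that takes $(L,\mathfrak{X})$ to the ordered extended convolution algebra $L^{\mathfrak{X}\uparrow}$, a morphism $\phi:L\to M$ to $\alpha\mapsto\phi\circ\alpha$, and an order $p$-morphism $p:\mathfrak{X}\to\mathfrak{Y}$ to $\beta\mapsto\beta\circ p$ from $L^{\mathfrak{Y}\uparrow}$ to $L^{\mathfrak{X}\uparrow}$.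
   Context: An extended type is $\tau=(\tau_1,\tau_2)$ with $\tau_1:I\to\mathbb{N}$, $\tau_2:J\to\mathbb{N}$. An ordered extended relational structure is $\mathfrak{X}=(X,\le,(R_i)_{i\in I},(S_j)_{j\in J})$ with $\le$ a partial order on $X$, $R_i\subseteq X^{n_i+1}$, $S_j\subseteq X^{n_j+1}$, such that if $(x_1,\ldots,x_{n_i},x)\in R_i$ and $x\le y$ then $(x_1,\ldots,x_{n_i},y)\in R_i$, and if $(x_1,\ldots,x_{n_j},x)\in S_j$ and $y\le x$ then $(x_1,\ldots,x_{n_j},y)\in S_j$. For a complete lattice $L$, $L^{\mathfrak{X}\uparrow}$ is the set of order-preserving functions $X\to L$ with pointwise $\wedge,\vee,0,1$ and operations $f_i(\alpha_1,\ldots,\alpha_{n_i})(x)=\bigvee\{\alpha_1(x_1)\wedge\cdots\wedge\alpha_{n_i}(x_{n_i}):(x_1,\ldots,x_{n_i},x)\in R_i\}$ and $g_j(\alpha_1,\ldots,\alpha_{n_j})(x)=\bigwedge\{\alpha_1(x_1)\vee\cdots\vee\alpha_{n_j}(x_{n_j}):(x_1,\ldots,x_{n_j},x)\in S_j\}$. An order $p$-morphism is an order-preserving map $p:X\to Y$ such that for every relation (of either family) $T$ on $X$ with corresponding $T'$ on $Y$, of arity $n+1$, and each $x\in X$: $\{(y_1,\ldots,y_n):(y_1,\ldots,y_n,p(x))\in T'\}=\{(p(x_1),\ldots,p(x_n)):(x_1,\ldots,x_n,x)\in T\}$. -}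

module Defs where

open import Level using (Level; _⊔_; suc)
open import Data.Nat using (ℕ)
open import Data.Vec using (Vec; []; _∷_; map; zipWith; foldr′)
open import Data.Vec.Relation.Unary.All using (All)
open import Data.Vec.Relation.Binary.Pointwise.Inductive using (Pointwise)
open import Data.Product using (Σ; _×_; _,_; proj₁; proj₂; ∃)
open import Function using (_∘_; _$_)
open import Relation.Binary.Core using (Rel)
open import Relation.Binary.Structures using (IsPartialOrder)
open import Relation.Binary.PropositionalEquality using (_≡_)
open import Algebra.Core using (Op₂)
open import Algebra.Definitions using (Identity)
open import Algebra.Lattice.Structures using (IsLattice)

record ExtType (t : Level) : Set (suc t) where
  field
    I  : Set t
    J  : Set t
    τ₁ : I → ℕ
    τ₂ : J → ℕ

record CompleteLattice (c ι : Level) : Set (suc (c ⊔ ι)) where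
  infixr 7 _∧_
  infixr 6 _∨_
  field
    Carrier        : Set c
    _≤_            : Rel Carrier c
    isPartialOrder : IsPartialOrder _≡_ _≤_
    _∧_ _∨_        : Carrier → Carrier → Carrier
    ⊤ ⊥            : Carrier
    ⋁ ⋀            : {K : Set ι} → (K → Carrier) → Carrier
    ∧-lb₁  : ∀ x y → (x ∧ y) ≤ x
    ∧-lb₂  : ∀ x y → (x ∧ y) ≤ y
    ∧-glb  : ∀ {x y z} → z ≤ x → z ≤ y → z ≤ (x ∧ y)
    ∨-ub₁  : ∀ x y → x ≤ (x ∨ y)
    ∨-ub₂  : ∀ x y → y ≤ (x ∨ y)
    ∨-lub  : ∀ {x y z} → x ≤ z → y ≤ z → (x ∨ y) ≤ z
    ⊤-max  : ∀ x → x ≤ ⊤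
    ⊥-min  : ∀ x → ⊥ ≤ x
    ⋁-ub   : ∀ {K : Set ι} (h : K → Carrier) k → h k ≤ ⋁ h
    ⋁-lub  : ∀ {K : Set ι} (h : K → Carrier) {z} → (∀ k → h k ≤ z) → ⋁ h ≤ z
    ⋀-lb   : ∀ {K : Set ι} (h : K → Carrier) k → ⋀ h ≤ h k
    ⋀-glb  : ∀ {K : Set ι} (h : K → Carrier) {z} → (∀ k → z ≤ h k) → z ≤ ⋀ h

  bigMeet : ∀ {n} → Vec Carrier n → Carrier
  bigMeet = foldr′ _∧_ ⊤

  bigJoin : ∀ {n} → Vec Carrier n → Carrier
  bigJoin = foldr′ _∨_ ⊥

module CL = CompleteLattice
open CompleteLattice using (Carrier)

record LatStarHom {c c' ι : Level} (L : CompleteLattice c ι) (M : CompleteLattice c' ι)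
       : Set (c ⊔ c' ⊔ suc ι) where
  field
    fun   : Carrier L → Carrier M
    pres-⊥ : fun (CL.⊥ L) ≡ CL.⊥ M
    pres-⊤ : fun (CL.⊤ L) ≡ CL.⊤ M
    pres-⋁ : ∀ {K : Set ι} (h : K → Carrier L) → fun (CL.⋁ L h) ≡ CL.⋁ M (fun ∘ h)
    pres-⋀ : ∀ {K : Set ι} (h : K → Carrier L) → fun (CL.⋀ L h) ≡ CL.⋀ M (fun ∘ h)

module _ {t : Level} (τ : ExtType t) where
  open ExtType τ

  record OrdRelStr (ι : Level) : Set (t ⊔ suc ι) where
    field
      X              : Set ι
      _≤_            : Rel X ι
      isPartialOrder : IsPartialOrder _≡_ _≤_
      R : (i : I) → Vec X (τ₁ i) → X → Set ι
      S : (j : J) → Vec X (τ₂ j) → X → Set ι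
      R-up   : ∀ {i xs x y} → R i xs x → x ≤ y → R i xs y
      S-down : ∀ {j xs x y} → S j xs x → y ≤ x → S j xs y

  open OrdRelStr

  record OrderPMorphism {ι : Level} (𝔛 𝔜 : OrdRelStr ι) : Set (t ⊔ ι) where
    field
      fun   : X 𝔛 → X 𝔜
      mono  : ∀ {x y} → _≤_ 𝔛 x y → _≤_ 𝔜 (fun x) (fun y)
      -- {ys : (ys, p x) ∈ R'} = {p xs : (xs, x) ∈ R}  (as sets of tuples)
      R-forth : ∀ {i xs x} → R 𝔛 i xs x → R 𝔜 i (map fun xs) (fun x)
      R-back  : ∀ {i ys x} → R 𝔜 i ys (fun x) → ∃ λ xs → R 𝔛 i xs x × map fun xs ≡ ys
      S-forth : ∀ {j xs x} → S 𝔛 j xs x → S 𝔜 j (map fun xs) (fun x)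
      S-back  : ∀ {j ys x} → S 𝔜 j ys (fun x) → ∃ λ xs → S 𝔛 j xs x × map fun xs ≡ ys

  record RawAlg (a ℓ : Level) : Set (t ⊔ suc (a ⊔ ℓ)) where
    field
      Carrier : Set a
      _≈_     : Rel Carrier ℓ
      _∧_ _∨_ : Op₂ Carrier
      ⊤ ⊥     : Carrier
      f       : (i : I) → Vec Carrier (τ₁ i) → Carrier
      g       : (j : J) → Vec Carrier (τ₂ j) → Carrier

  record IsAlg {a ℓ} (A : RawAlg a ℓ) : Set (t ⊔ a ⊔ ℓ) where
    open RawAlg A
    field
      isLattice  : IsLattice _≈_ _∨_ _∧_
      ⊥-identity : Identity _≈_ ⊥ _∨_
      ⊤-identity : Identity _≈_ ⊤ _∧_
      f-cong : ∀ i {as bs} → Pointwise _≈_ as bs → f i as ≈ f i bs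
      g-cong : ∀ j {as bs} → Pointwise _≈_ as bs → g j as ≈ g j bs

  record IsAlgHom {a ℓ a' ℓ'} (A : RawAlg a ℓ) (B : RawAlg a' ℓ')
                  (h : RawAlg.Carrier A → RawAlg.Carrier B) : Set (t ⊔ a ⊔ ℓ ⊔ ℓ') where
    module A = RawAlg A
    module B = RawAlg B
    field
      cong  : ∀ {x y} → x A.≈ y → h x B.≈ h y
      pres-∧ : ∀ x y → h (x A.∧ y) B.≈ (h x B.∧ h y)
      pres-∨ : ∀ x y → h (x A.∨ y) B.≈ (h x B.∨ h y)
      pres-⊤ : h A.⊤ B.≈ B.⊤
      pres-⊥ : h A.⊥ B.≈ B.⊥
      pres-f : ∀ i as → h (A.f i as) B.≈ B.f i (map h as)
      pres-g : ∀ j as → h (A.g j as) B.≈ B.g j (map h as)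

  module _ {c ι : Level} (L : CompleteLattice c ι) (𝔛 : OrdRelStr ι) where

    Monotone : (X 𝔛 → Carrier L) → Set (c ⊔ ι)
    Monotone α = ∀ {x y} → _≤_ 𝔛 x y → CL._≤_ L (α x) (α y)

    _∧ᶜ_ _∨ᶜ_ : (X 𝔛 → Carrier L) → (X 𝔛 → Carrier L) → (X 𝔛 → Carrier L)
    (α ∧ᶜ β) x = CL._∧_ L (α x) (β x)
    (α ∨ᶜ β) x = CL._∨_ L (α x) (β x)

    ⊤ᶜ ⊥ᶜ : X 𝔛 → Carrier L
    ⊤ᶜ _ = CL.⊤ L
    ⊥ᶜ _ = CL.⊥ L

    fᶜ : (i : I) → Vec (X 𝔛 → Carrier L) (τ₁ i) → X 𝔛 → Carrier L
    fᶜ i αs x = CL.⋁ L {K = Σ (Vec (X 𝔛) (τ₁ i)) (λ xs → R 𝔛 i xs x)}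
                  (λ p → CL.bigMeet L (zipWith _$_ αs (proj₁ p)))

    gᶜ : (j : J) → Vec (X 𝔛 → Carrier L) (τ₂ j) → X 𝔛 → Carrier L
    gᶜ j αs x = CL.⋀ L {K = Σ (Vec (X 𝔛) (τ₂ j)) (λ xs → S 𝔛 j xs x)}
                  (λ p → CL.bigJoin L (zipWith _$_ αs (proj₁ p)))

    record ClosedUp : Set (t ⊔ c ⊔ ι) where
      field
        ∧-mono : ∀ α β → Monotone α → Monotone β → Monotone (α ∧ᶜ β)
        ∨-mono : ∀ α β → Monotone α → Monotone β → Monotone (α ∨ᶜ β)
        ⊤-mono : Monotone ⊤ᶜ
        ⊥-mono : Monotone ⊥ᶜ
        f-mono : ∀ i αs → All Monotone αs → Monotone (fᶜ i αs)
        g-mono : ∀ j αs → All Monotone αs → Monotone (gᶜ j αs)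

    Up : Set (c ⊔ ι)
    Up = Σ (X 𝔛 → Carrier L) Monotone

    _≈↑_ : Rel Up (c ⊔ ι)
    a ≈↑ b = ∀ x → proj₁ a x ≡ proj₁ b x

    private
      allMono : ∀ {n} (as : Vec Up n) → All Monotone (map proj₁ as)
      allMono []       = All.[]
      allMono (a ∷ as) = proj₂ a All.∷ allMono as

    ConvAlg : ClosedUp → RawAlg (c ⊔ ι) (c ⊔ ι)
    ConvAlg cl = record
      { Carrier = Up
      ; _≈_ = _≈↑_
      ; _∧_ = λ a b → (proj₁ a ∧ᶜ proj₁ b) , ∧-mono (proj₁ a) (proj₁ b) (proj₂ a) (proj₂ b)
      ; _∨_ = λ a b → (proj₁ a ∨ᶜ proj₁ b) , ∨-mono (proj₁ a) (proj₁ b) (proj₂ a) (proj₂ b)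
      ; ⊤ = ⊤ᶜ , ⊤-mono
      ; ⊥ = ⊥ᶜ , ⊥-mono
      ; f = λ i as → fᶜ i (map proj₁ as) , f-mono i (map proj₁ as) (allMono as)
      ; g = λ j as → gᶜ j (map proj₁ as) , g-mono j (map proj₁ as) (allMono as)
      }
      where open ClosedUp cl

  postMap : ∀ {c c' ι} (L : CompleteLattice c ι) (M : CompleteLattice c' ι) (𝔛 : OrdRelStr ι)
            (φ : LatStarHom L M) →
            (∀ α → Monotone L 𝔛 α → Monotone M 𝔛 (LatStarHom.fun φ ∘ α)) →
            Up L 𝔛 → Up M 𝔛
  postMap L M 𝔛 φ pc (α , m) = LatStarHom.fun φ ∘ α , pc α m

  preMap : ∀ {c ι} (L : CompleteLattice c ι) (𝔛 𝔜 : OrdRelStr ι)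
           (p : OrderPMorphism 𝔛 𝔜) →
           (∀ β → Monotone L 𝔜 β → Monotone L 𝔛 (β ∘ OrderPMorphism.fun p)) →
           Up L 𝔜 → Up L 𝔛
  preMap L 𝔛 𝔜 p pm (β , m) = β ∘ OrderPMorphism.fun p , pm β m

module Submission where

-- The proof has three layers.
--   1. Every complete lattice is in particular an order-theoretic bounded
--      lattice, so the algebraic lattice laws come from the standard library;
--      we add two comparison principles for arbitrary joins and meets
--      (a family dominated by another has the smaller join, dually for meets).
--   2. A Lat*-morphism preserves binary joins and meets (they are joins and
--      meets of two-element families), hence is monotone and preserves the
--      finite joins and meets used in the convolution operations.
--   3. For the convolution algebra: monotonicity of fᵢ(α⃗) and gⱼ(α⃗) is the
--      up/down-closure of Rᵢ and Sⱼ; the lattice laws hold pointwise; and the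
--      two actions are homomorphisms because fᵢ, gⱼ commute with φ ∘ _ (φ
--      preserves ⋁, ⋀ and finite ∧, ∨) and with _ ∘ p (the p-morphism
--      condition says exactly that the index sets of the joins and meets
--      correspond under p).

open import Defs
open import Level using (Level; Lift; lift)
open import Data.Bool using (Bool; true; false)
open import Data.Product using (Σ; ∃; _×_; _,_; proj₁; proj₂)
open import Data.Vec using (Vec; []; _∷_; map; zipWith)
open import Data.Vec.Properties using (zipWith-map₁; zipWith-map₂)
open import Data.Vec.Relation.Binary.Pointwise.Inductive using (Pointwise; []; _∷_)
open import Function using (_∘_; _$_)
open import Relation.Binary.PropositionalEquality using (_≡_; refl; sym; trans; cong; cong₂; module ≡-Reasoning)
open import Relation.Binary.Structures using (IsPartialOrder)
open import Relation.Binary.Lattice using (BoundedLattice)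
open import Algebra.Lattice.Structures using (IsLattice)
import Relation.Binary.Lattice.Properties.Lattice as LatticeProperties
import Relation.Binary.Lattice.Properties.JoinSemilattice as JoinProperties
import Relation.Binary.Lattice.Properties.MeetSemilattice as MeetProperties
import Relation.Binary.Lattice.Properties.BoundedJoinSemilattice as BoundedJoinProperties
import Relation.Binary.Lattice.Properties.BoundedMeetSemilattice as BoundedMeetProperties

module CompleteLatticeLaws {c ι : Level} (L : CompleteLattice c ι) where
  open CompleteLattice L
  open IsPartialOrder isPartialOrder public
    using (antisym) renaming (refl to ≤-refl; trans to ≤-trans; reflexive to ≤-reflexive)

  boundedLattice : BoundedLattice c c c
  boundedLattice = record
    { isBoundedLattice = record
      { isLattice = record
        { isPartialOrder = isPartialOrder
        ; supremum = λ x y → ∨-ub₁ x y , ∨-ub₂ x y , λ _ → ∨-lub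
        ; infimum  = λ x y → ∧-lb₁ x y , ∧-lb₂ x y , λ _ → ∧-glb
        }
      ; maximum = ⊤-max
      ; minimum = ⊥-min
      }
    }

  open BoundedLattice boundedLattice using (lattice; joinSemilattice; meetSemilattice; boundedJoinSemilattice; boundedMeetSemilattice)
  open LatticeProperties lattice public using (isAlgLattice)
  open JoinProperties joinSemilattice public using (∨-monotonic; x≤y⇒x∨y≈y)
  open BoundedJoinProperties boundedJoinSemilattice public renaming (identity to ⊥-∨-identity) using ()
  open BoundedMeetProperties boundedMeetSemilattice public renaming (identity to ⊤-∧-identity) using ()

  -- ∧ is monotone: ∨ is monotone in the dual (order-reversed) lattice.
  ∧-monotonic : ∀ {x x' y y'} → x ≤ x' → y ≤ y' → (x ∧ y) ≤ (x' ∧ y')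
  ∧-monotonic = JoinProperties.∨-monotonic (MeetProperties.dualJoinSemilattice meetSemilattice)

  ⋁-dominated : ∀ {K K' : Set ι} (h : K → Carrier) (h' : K' → Carrier) →
                (∀ k → ∃ λ k' → h k ≤ h' k') → ⋁ h ≤ ⋁ h'
  ⋁-dominated h h' dom = ⋁-lub h λ k →
    let (k' , hk≤h'k') = dom k in ≤-trans hk≤h'k' (⋁-ub h' k')

  ⋀-dominated : ∀ {K K' : Set ι} (h : K → Carrier) (h' : K' → Carrier) →
                (∀ k' → ∃ λ k → h k ≤ h' k') → ⋀ h ≤ ⋀ h'
  ⋀-dominated h h' dom = ⋀-glb h' λ k' →
    let (k , hk≤h'k') = dom k' in ≤-trans (⋀-lb h k) hk≤h'k'

  -- Arbitrary joins and meets of pointwise equal families agree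
  -- (needed since we have no function extensionality).
  ⋁-cong : ∀ {K : Set ι} {h h' : K → Carrier} → (∀ k → h k ≡ h' k) → ⋁ h ≡ ⋁ h'
  ⋁-cong {h = h} {h'} h≗h' = antisym
    (⋁-dominated h h' λ k → k , ≤-reflexive (h≗h' k))
    (⋁-dominated h' h λ k → k , ≤-reflexive (sym (h≗h' k)))

  ⋀-cong : ∀ {K : Set ι} {h h' : K → Carrier} → (∀ k → h k ≡ h' k) → ⋀ h ≡ ⋀ h'
  ⋀-cong {h = h} {h'} h≗h' = antisym
    (⋀-dominated h h' λ k → k , ≤-reflexive (h≗h' k))
    (⋀-dominated h' h λ k → k , ≤-reflexive (sym (h≗h' k)))

  pair : Carrier → Carrier → Lift ι Bool → Carrier
  pair x y (lift true)  = x
  pair x y (lift false) = y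

  ⋁-pair : ∀ x y → ⋁ (pair x y) ≡ x ∨ y
  ⋁-pair x y = antisym
    (⋁-lub (pair x y) λ { (lift true) → ∨-ub₁ x y ; (lift false) → ∨-ub₂ x y })
    (∨-lub (⋁-ub (pair x y) (lift true)) (⋁-ub (pair x y) (lift false)))

  ⋀-pair : ∀ x y → ⋀ (pair x y) ≡ x ∧ y
  ⋀-pair x y = antisym
    (∧-glb (⋀-lb (pair x y) (lift true)) (⋀-lb (pair x y) (lift false)))
    (⋀-glb (pair x y) λ { (lift true) → ∧-lb₁ x y ; (lift false) → ∧-lb₂ x y })

module LatStarHomLaws {c c' ι : Level} {L : CompleteLattice c ι} {M : CompleteLattice c' ι}
                      (φ : LatStarHom L M) where
  open LatStarHom φ
  private
    module L = CompleteLattice L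
    module M = CompleteLattice M
    module LL = CompleteLatticeLaws L
    module ML = CompleteLatticeLaws M

  pair-natural : ∀ x y k → fun (LL.pair x y k) ≡ ML.pair (fun x) (fun y) k
  pair-natural x y (lift true)  = refl
  pair-natural x y (lift false) = refl

  -- Binary joins and meets are joins and meets of two-element families.
  pres-∨ : ∀ x y → fun (x L.∨ y) ≡ fun x M.∨ fun y
  pres-∨ x y = begin
    fun (x L.∨ y)                     ≡⟨ cong fun (sym (LL.⋁-pair x y)) ⟩
    fun (L.⋁ (LL.pair x y))           ≡⟨ pres-⋁ (LL.pair x y) ⟩
    M.⋁ (fun ∘ LL.pair x y)           ≡⟨ ML.⋁-cong (pair-natural x y) ⟩
    M.⋁ (ML.pair (fun x) (fun y))     ≡⟨ ML.⋁-pair (fun x) (fun y) ⟩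
    fun x M.∨ fun y                   ∎
    where open ≡-Reasoning

  pres-∧ : ∀ x y → fun (x L.∧ y) ≡ fun x M.∧ fun y
  pres-∧ x y = begin
    fun (x L.∧ y)                     ≡⟨ cong fun (sym (LL.⋀-pair x y)) ⟩
    fun (L.⋀ (LL.pair x y))           ≡⟨ pres-⋀ (LL.pair x y) ⟩
    M.⋀ (fun ∘ LL.pair x y)           ≡⟨ ML.⋀-cong (pair-natural x y) ⟩
    M.⋀ (ML.pair (fun x) (fun y))     ≡⟨ ML.⋀-pair (fun x) (fun y) ⟩
    fun x M.∧ fun y                   ∎
    where open ≡-Reasoning

  -- x ≤ y iff x ∨ y = y, and φ preserves ∨.
  monotone : ∀ {x y} → x L.≤ y → fun x M.≤ fun y
  monotone {x} {y} x≤y = ML.≤-trans (M.∨-ub₁ (fun x) (fun y))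
    (ML.≤-reflexive (trans (sym (pres-∨ x y)) (cong fun (LL.x≤y⇒x∨y≈y x≤y))))

  pres-bigMeet : ∀ {n} (v : Vec L.Carrier n) → fun (L.bigMeet v) ≡ M.bigMeet (map fun v)
  pres-bigMeet []      = pres-⊤
  pres-bigMeet (x ∷ v) = trans (pres-∧ x (L.bigMeet v)) (cong (fun x M.∧_) (pres-bigMeet v))

  pres-bigJoin : ∀ {n} (v : Vec L.Carrier n) → fun (L.bigJoin v) ≡ M.bigJoin (map fun v)
  pres-bigJoin []      = pres-⊥
  pres-bigJoin (x ∷ v) = trans (pres-∨ x (L.bigJoin v)) (cong (fun x M.∨_) (pres-bigJoin v))

module _ {a b} {A : Set a} {B : Set b} where

  map-apply : ∀ {d n} {C : Set d} (h : B → C) (αs : Vec (A → B) n) (xs : Vec A n) →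
              map h (zipWith _$_ αs xs) ≡ zipWith _$_ (map (h ∘_) αs) xs
  map-apply h []       []       = refl
  map-apply h (α ∷ αs) (x ∷ xs) = cong (h (α x) ∷_) (map-apply h αs xs)

  apply-precompose : ∀ {d n} {C : Set d} (p : A → B) (βs : Vec (B → C) n) (xs : Vec A n) →
                     zipWith _$_ (map (_∘ p) βs) xs ≡ zipWith _$_ βs (map p xs)
  apply-precompose p βs xs = trans (zipWith-map₁ _$_ (_∘ p) βs xs) (sym (zipWith-map₂ _$_ p βs xs))

  apply-cong : ∀ {u n} {U : Set u} (ev : U → A → B) {us vs : Vec U n} →
               Pointwise (λ u v → ∀ x → ev u x ≡ ev v x) us vs →
               (xs : Vec A n) → zipWith _$_ (map ev us) xs ≡ zipWith _$_ (map ev vs) xs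
  apply-cong ev []           []       = refl
  apply-cong ev (u≗v ∷ us≗vs) (x ∷ xs) = cong₂ _∷_ (u≗v x) (apply-cong ev us≗vs xs)

map-proj₁-natural : ∀ {a b p q n} {A : Set a} {B : Set b} {P : A → Set p} {Q : B → Set q}
                    (h : Σ A P → Σ B Q) (k : A → B) → (∀ u → proj₁ (h u) ≡ k (proj₁ u)) →
                    (us : Vec (Σ A P) n) → map proj₁ (map h us) ≡ map k (map proj₁ us)
map-proj₁-natural h k h≈k []       = refl
map-proj₁-natural h k h≈k (u ∷ us) = cong₂ _∷_ (h≈k u) (map-proj₁-natural h k h≈k us)

module ConvolutionAlgebra {t : Level} (τ : ExtType t) {c ι : Level} where
  open OrdRelStr
  open OrderPMorphism using (R-forth; R-back; S-forth; S-back)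

  -- fᵢ(α⃗) and gⱼ(α⃗) are order-preserving for any α⃗, because Rᵢ is closed
  -- upwards and Sⱼ downwards in the last coordinate; ∧, ∨ are monotone.
  closedUp : (L : CompleteLattice c ι) (𝔛 : OrdRelStr τ ι) → ClosedUp τ L 𝔛
  closedUp L 𝔛 = record
    { ∧-mono = λ α β α↑ β↑ x≤y → ∧-monotonic (α↑ x≤y) (β↑ x≤y)
    ; ∨-mono = λ α β α↑ β↑ x≤y → ∨-monotonic (α↑ x≤y) (β↑ x≤y)
    ; ⊤-mono = λ _ → ≤-refl
    ; ⊥-mono = λ _ → ≤-refl
    ; f-mono = λ i αs _ x≤y → ⋁-dominated _ _ λ { (xs , r) → (xs , R-up 𝔛 r x≤y) , ≤-refl }
    ; g-mono = λ j αs _ y≤x → ⋀-dominated _ _ λ { (xs , s) → (xs , S-down 𝔛 s y≤x) , ≤-refl }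
    }
    where open CompleteLatticeLaws L

  isAlg : (L : CompleteLattice c ι) (𝔛 : OrdRelStr τ ι) (cl : ClosedUp τ L 𝔛) →
          IsAlg τ (ConvAlg τ L 𝔛 cl)
  isAlg L 𝔛 cl = record
    { isLattice = record
      { isEquivalence = record
        { refl  = λ _ → refl
        ; sym   = λ a≈b x → sym (a≈b x)
        ; trans = λ a≈b b≈d x → trans (a≈b x) (b≈d x)
        }
      ; ∨-comm     = λ a b x → ∨-comm _ _
      ; ∨-assoc    = λ a b d x → ∨-assoc _ _ _
      ; ∨-cong     = λ a≈a' b≈b' x → cong₂ (CompleteLattice._∨_ L) (a≈a' x) (b≈b' x)
      ; ∧-comm     = λ a b x → ∧-comm _ _
      ; ∧-assoc    = λ a b d x → ∧-assoc _ _ _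
      ; ∧-cong     = λ a≈a' b≈b' x → cong₂ (CompleteLattice._∧_ L) (a≈a' x) (b≈b' x)
      ; absorptive = (λ a b x → proj₁ absorptive _ _) , (λ a b x → proj₂ absorptive _ _)
      }
    ; ⊥-identity = (λ a x → proj₁ ⊥-∨-identity _) , (λ a x → proj₂ ⊥-∨-identity _)
    ; ⊤-identity = (λ a x → proj₁ ⊤-∧-identity _) , (λ a x → proj₂ ⊤-∧-identity _)
    ; f-cong = λ i as≈bs x → ⋁-cong λ q → cong bigMeet (apply-cong proj₁ as≈bs (proj₁ q))
    ; g-cong = λ j as≈bs x → ⋀-cong λ q → cong bigJoin (apply-cong proj₁ as≈bs (proj₁ q))
    }
    where open CompleteLattice L using (bigMeet; bigJoin)
          open CompleteLatticeLaws L
          open IsLattice isAlgLattice using (∨-comm; ∨-assoc; ∧-comm; ∧-assoc; absorptive)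

  -- Covariant action: the convolution operations commute with φ ∘ _, since
  -- φ preserves arbitrary joins/meets and the finite ones inside them.
  module _ {L M : CompleteLattice c ι} (φ : LatStarHom L M) (𝔛 : OrdRelStr τ ι) where
    open LatStarHom φ using (fun; pres-⋁; pres-⋀)
    open LatStarHomLaws φ using (pres-bigMeet; pres-bigJoin)
    private
      module ML = CompleteLatticeLaws M

    fᶜ-postcompose : ∀ i αs x → fun (fᶜ τ L 𝔛 i αs x) ≡ fᶜ τ M 𝔛 i (map (fun ∘_) αs) x
    fᶜ-postcompose i αs x = trans (pres-⋁ _) (ML.⋁-cong λ { (xs , _) →
      trans (pres-bigMeet (zipWith _$_ αs xs)) (cong (CompleteLattice.bigMeet M) (map-apply fun αs xs)) })

    gᶜ-postcompose : ∀ j αs x → fun (gᶜ τ L 𝔛 j αs x) ≡ gᶜ τ M 𝔛 j (map (fun ∘_) αs) x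
    gᶜ-postcompose j αs x = trans (pres-⋀ _) (ML.⋀-cong λ { (xs , _) →
      trans (pres-bigJoin (zipWith _$_ αs xs)) (cong (CompleteLattice.bigJoin M) (map-apply fun αs xs)) })

  postMap-monotone : (L M : CompleteLattice c ι) (φ : LatStarHom L M) (𝔛 : OrdRelStr τ ι) →
    ∀ α → Monotone τ L 𝔛 α → Monotone τ M 𝔛 (LatStarHom.fun φ ∘ α)
  postMap-monotone L M φ 𝔛 α α↑ x≤y = LatStarHomLaws.monotone φ (α↑ x≤y)

  postMap-isHom : (L M : CompleteLattice c ι) (φ : LatStarHom L M) (𝔛 : OrdRelStr τ ι)
    (clL : ClosedUp τ L 𝔛) (clM : ClosedUp τ M 𝔛)
    (pc : ∀ α → Monotone τ L 𝔛 α → Monotone τ M 𝔛 (LatStarHom.fun φ ∘ α)) →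
    IsAlgHom τ (ConvAlg τ L 𝔛 clL) (ConvAlg τ M 𝔛 clM) (postMap τ L M 𝔛 φ pc)
  postMap-isHom L M φ 𝔛 clL clM pc = record
    { cong   = λ a≈b x → cong fun (a≈b x)
    ; pres-∧ = λ a b x → pres-∧ _ _
    ; pres-∨ = λ a b x → pres-∨ _ _
    ; pres-⊤ = λ x → pres-⊤
    ; pres-⊥ = λ x → pres-⊥
    ; pres-f = λ i as x → trans (fᶜ-postcompose φ 𝔛 i (map proj₁ as) x)
                                (cong (λ αs → fᶜ τ M 𝔛 i αs x) (sym (underlying as)))
    ; pres-g = λ j as x → trans (gᶜ-postcompose φ 𝔛 j (map proj₁ as) x)
                                (cong (λ αs → gᶜ τ M 𝔛 j αs x) (sym (underlying as)))
    }
    where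
      open LatStarHom φ using (fun; pres-⊤; pres-⊥)
      open LatStarHomLaws φ using (pres-∧; pres-∨)
      underlying : ∀ {n} (as : Vec (Up τ L 𝔛) n) →
                   map proj₁ (map (postMap τ L M 𝔛 φ pc) as) ≡ map (fun ∘_) (map proj₁ as)
      underlying = map-proj₁-natural (postMap τ L M 𝔛 φ pc) (fun ∘_) (λ _ → refl)

  -- Contravariant action: the convolution operations commute with _ ∘ p.
  -- The p-morphism condition says that the index set of fᵢ(β⃗)(p x) is the
  -- image under p of that of fᵢ(β⃗ ∘ p)(x), so each join dominates the other
  -- (dually for gⱼ).
  module _ (L : CompleteLattice c ι) {𝔛 𝔜 : OrdRelStr τ ι} (p : OrderPMorphism τ 𝔛 𝔜) where
    open CompleteLattice L using (bigMeet; bigJoin)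
    open CompleteLatticeLaws L
    open OrderPMorphism p using (fun)

    apply-along : ∀ {n} (βs : Vec (X 𝔜 → CompleteLattice.Carrier L) n) {xs ys} → map fun xs ≡ ys →
                  zipWith _$_ (map (_∘ fun) βs) xs ≡ zipWith _$_ βs ys
    apply-along βs {xs} refl = apply-precompose fun βs xs

    fᶜ-precompose : ∀ i βs x → fᶜ τ L 𝔛 i (map (_∘ fun) βs) x ≡ fᶜ τ L 𝔜 i βs (fun x)
    fᶜ-precompose i βs x = antisym
      (⋁-dominated _ _ λ { (xs , r) →
        (map fun xs , R-forth p r) , ≤-reflexive (cong bigMeet (apply-along βs refl)) })
      (⋁-dominated _ _ λ { (ys , r) → let (xs , r' , p[xs]≡ys) = R-back p r in
        (xs , r') , ≤-reflexive (cong bigMeet (sym (apply-along βs p[xs]≡ys))) })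

    gᶜ-precompose : ∀ j βs x → gᶜ τ L 𝔛 j (map (_∘ fun) βs) x ≡ gᶜ τ L 𝔜 j βs (fun x)
    gᶜ-precompose j βs x = antisym
      (⋀-dominated _ _ λ { (ys , s) → let (xs , s' , p[xs]≡ys) = S-back p s in
        (xs , s') , ≤-reflexive (cong bigJoin (apply-along βs p[xs]≡ys)) })
      (⋀-dominated _ _ λ { (xs , s) →
        (map fun xs , S-forth p s) , ≤-reflexive (cong bigJoin (sym (apply-along βs refl))) })

  preMap-monotone : (L : CompleteLattice c ι) (𝔛 𝔜 : OrdRelStr τ ι) (p : OrderPMorphism τ 𝔛 𝔜) →
    ∀ β → Monotone τ L 𝔜 β → Monotone τ L 𝔛 (β ∘ OrderPMorphism.fun p)
  preMap-monotone L 𝔛 𝔜 p β β↑ x≤y = β↑ (OrderPMorphism.mono p x≤y)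

  preMap-isHom : (L : CompleteLattice c ι) (𝔛 𝔜 : OrdRelStr τ ι) (p : OrderPMorphism τ 𝔛 𝔜)
    (clX : ClosedUp τ L 𝔛) (clY : ClosedUp τ L 𝔜)
    (pm : ∀ β → Monotone τ L 𝔜 β → Monotone τ L 𝔛 (β ∘ OrderPMorphism.fun p)) →
    IsAlgHom τ (ConvAlg τ L 𝔜 clY) (ConvAlg τ L 𝔛 clX) (preMap τ L 𝔛 𝔜 p pm)
  preMap-isHom L 𝔛 𝔜 p clX clY pm = record
    { cong   = λ a≈b x → a≈b (fun x)
    ; pres-∧ = λ a b x → refl
    ; pres-∨ = λ a b x → refl
    ; pres-⊤ = λ x → refl
    ; pres-⊥ = λ x → refl
    ; pres-f = λ i as x → trans (sym (fᶜ-precompose L p i (map proj₁ as) x))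
                                (cong (λ αs → fᶜ τ L 𝔛 i αs x) (sym (underlying as)))
    ; pres-g = λ j as x → trans (sym (gᶜ-precompose L p j (map proj₁ as) x))
                                (cong (λ αs → gᶜ τ L 𝔛 j αs x) (sym (underlying as)))
    }
    where
      open OrderPMorphism p using (fun)
      underlying : ∀ {n} (as : Vec (Up τ L 𝔜) n) →
                   map proj₁ (map (preMap τ L 𝔛 𝔜 p pm) as) ≡ map (_∘ fun) (map proj₁ as)
      underlying = map-proj₁-natural (preMap τ L 𝔛 𝔜 p pm) (_∘ fun) (λ _ → refl)

theorem5p21 : ∀ {t : Level} (τ : ExtType t) {c ι : Level} →
  -- object part: L^{𝔛↑} is well defined and is an algebra of type τ
  ((L : CompleteLattice c ι) (𝔛 : OrdRelStr τ ι) → ClosedUp τ L 𝔛)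
  × ((L : CompleteLattice c ι) (𝔛 : OrdRelStr τ ι) (cl : ClosedUp τ L 𝔛) →
      IsAlg τ (ConvAlg τ L 𝔛 cl))
  -- covariant action of Lat* morphisms φ : L → M, α ↦ φ ∘ α
  × ((L M : CompleteLattice c ι) (φ : LatStarHom L M) (𝔛 : OrdRelStr τ ι) →
      (∀ α → Monotone τ L 𝔛 α → Monotone τ M 𝔛 (LatStarHom.fun φ ∘ α)))
  × ((L M : CompleteLattice c ι) (φ : LatStarHom L M) (𝔛 : OrdRelStr τ ι)
     (clL : ClosedUp τ L 𝔛) (clM : ClosedUp τ M 𝔛)
     (pc : ∀ α → Monotone τ L 𝔛 α → Monotone τ M 𝔛 (LatStarHom.fun φ ∘ α)) →
      IsAlgHom τ (ConvAlg τ L 𝔛 clL) (ConvAlg τ M 𝔛 clM) (postMap τ L M 𝔛 φ pc))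
  -- contravariant action of order p-morphisms p : 𝔛 → 𝔜, β ↦ β ∘ p
  × ((L : CompleteLattice c ι) (𝔛 𝔜 : OrdRelStr τ ι) (p : OrderPMorphism τ 𝔛 𝔜) →
      (∀ β → Monotone τ L 𝔜 β → Monotone τ L 𝔛 (β ∘ OrderPMorphism.fun p)))
  × ((L : CompleteLattice c ι) (𝔛 𝔜 : OrdRelStr τ ι) (p : OrderPMorphism τ 𝔛 𝔜)
     (clX : ClosedUp τ L 𝔛) (clY : ClosedUp τ L 𝔜)
     (pm : ∀ β → Monotone τ L 𝔜 β → Monotone τ L 𝔛 (β ∘ OrderPMorphism.fun p)) →
      IsAlgHom τ (ConvAlg τ L 𝔜 clY) (ConvAlg τ L 𝔛 clX) (preMap τ L 𝔛 𝔜 p pm))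
  -- functoriality in the first argument: identities and composition
  × ((L : CompleteLattice c ι) (φ : LatStarHom L L) (𝔛 : OrdRelStr τ ι)
     (pc : ∀ α → Monotone τ L 𝔛 α → Monotone τ L 𝔛 (LatStarHom.fun φ ∘ α)) →
      (∀ x → LatStarHom.fun φ x ≡ x) →
      ∀ a y → proj₁ (postMap τ L L 𝔛 φ pc a) y ≡ proj₁ a y)
  × ((L M N : CompleteLattice c ι) (φ : LatStarHom L M) (ψ : LatStarHom M N)
     (χ : LatStarHom L N) (𝔛 : OrdRelStr τ ι)
     (pφ : ∀ α → Monotone τ L 𝔛 α → Monotone τ M 𝔛 (LatStarHom.fun φ ∘ α))
     (pψ : ∀ α → Monotone τ M 𝔛 α → Monotone τ N 𝔛 (LatStarHom.fun ψ ∘ α))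
     (pχ : ∀ α → Monotone τ L 𝔛 α → Monotone τ N 𝔛 (LatStarHom.fun χ ∘ α)) →
      (∀ x → LatStarHom.fun χ x ≡ LatStarHom.fun ψ (LatStarHom.fun φ x)) →
      ∀ a y → proj₁ (postMap τ L N 𝔛 χ pχ a) y ≡ proj₁ (postMap τ M N 𝔛 ψ pψ (postMap τ L M 𝔛 φ pφ a)) y)
  -- functoriality in the second argument: identities and composition
  × ((L : CompleteLattice c ι) (𝔛 : OrdRelStr τ ι) (p : OrderPMorphism τ 𝔛 𝔛)
     (pm : ∀ β → Monotone τ L 𝔛 β → Monotone τ L 𝔛 (β ∘ OrderPMorphism.fun p)) →
      (∀ x → OrderPMorphism.fun p x ≡ x) →
      ∀ b y → proj₁ (preMap τ L 𝔛 𝔛 p pm b) y ≡ proj₁ b y)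
  × ((L : CompleteLattice c ι) (𝔛 𝔜 ℨ : OrdRelStr τ ι)
     (p : OrderPMorphism τ 𝔛 𝔜) (q : OrderPMorphism τ 𝔜 ℨ) (r : OrderPMorphism τ 𝔛 ℨ)
     (pp : ∀ β → Monotone τ L 𝔜 β → Monotone τ L 𝔛 (β ∘ OrderPMorphism.fun p))
     (pq : ∀ β → Monotone τ L ℨ β → Monotone τ L 𝔜 (β ∘ OrderPMorphism.fun q))
     (pr : ∀ β → Monotone τ L ℨ β → Monotone τ L 𝔛 (β ∘ OrderPMorphism.fun r)) →
      (∀ x → OrderPMorphism.fun r x ≡ OrderPMorphism.fun q (OrderPMorphism.fun p x)) →
      ∀ b y → proj₁ (preMap τ L 𝔛 ℨ r pr b) y ≡ proj₁ (preMap τ L 𝔛 𝔜 p pp (preMap τ L 𝔜 ℨ q pq b)) y)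
  -- bifunctoriality: the two actions commute
  × ((L M : CompleteLattice c ι) (φ : LatStarHom L M) (𝔛 𝔜 : OrdRelStr τ ι)
     (p : OrderPMorphism τ 𝔛 𝔜)
     (pcX : ∀ α → Monotone τ L 𝔛 α → Monotone τ M 𝔛 (LatStarHom.fun φ ∘ α))
     (pcY : ∀ α → Monotone τ L 𝔜 α → Monotone τ M 𝔜 (LatStarHom.fun φ ∘ α))
     (pmL : ∀ β → Monotone τ L 𝔜 β → Monotone τ L 𝔛 (β ∘ OrderPMorphism.fun p))
     (pmM : ∀ β → Monotone τ M 𝔜 β → Monotone τ M 𝔛 (β ∘ OrderPMorphism.fun p)) →
      ∀ b y → proj₁ (postMap τ L M 𝔛 φ pcX (preMap τ L 𝔛 𝔜 p pmL b)) y
              ≡ proj₁ (preMap τ M 𝔛 𝔜 p pmM (postMap τ L M 𝔜 φ pcY b)) y)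
theorem5p21 τ =
    closedUp , isAlg
  , postMap-monotone , postMap-isHom
  , preMap-monotone , preMap-isHom
  , (λ L φ 𝔛 pc φ≗id a y → φ≗id (proj₁ a y))
  , (λ L M N φ ψ χ 𝔛 pφ pψ pχ χ≗ψ∘φ a y → χ≗ψ∘φ (proj₁ a y))
  , (λ L 𝔛 p pm p≗id b y → cong (proj₁ b) (p≗id y))
  , (λ L 𝔛 𝔜 ℨ p q r pp pq pr r≗q∘p b y → cong (proj₁ b) (r≗q∘p y))
  , (λ L M φ 𝔛 𝔜 p pcX pcY pmL pmM b y → refl)
  where open ConvolutionAlgebra τ
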